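{- Let $a,b,c\in\mathbb{Z}$ and suppose $f(x)=(x^2+ax)^2+b(x^2+ax)+c$ is irreducible. Write $x^2+bx+c=(x-\beta_1)(x-\beta_2)$ and $x^2+ax-\beta_i=(x-\alpha_{i,1})(x-\alpha_{i,2})$ for $i=1,2$, and order the roots of $f$ as $(\alpha_{1,1},\alpha_{1,2},\alpha_{2,1},\alpha_{2,2})$. Let $LR=\{(l_1,\dots,l_5)\in\mathbb{Q}^5\mid l_1\alpha_{1,1}+l_2\alpha_{1,2}+l_3\alpha_{2,1}+l_4\alpha_{2,2}=l_5\}$. Then the two vectors $(1,1,0,0,-a)$ and $(0,0,1,1,-a)$, corresponding to the relations $\alpha_{i,1}+\alpha_{i,2}=-a$ ($i=1,2$), form a $\mathbb{Z}$-basis of $LR\cap\mathbb{Z}^5$. -}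

module Defs where

open import Level using (Level)
open import Data.Nat using (ℕ; zero; suc)
open import Data.Integer as ℤ using (ℤ; +_; -[1+_])
open import Data.Rational as ℚ using (ℚ; 0ℚ; 1ℚ; _/_)
open import Data.List using (List; []; _∷_; map)
open import Data.Vec using (Vec; []; _∷_; zipWith)
import Data.Vec as Vec
open import Data.Product using (Σ; _×_; ∃)
open import Data.Sum using (_⊎_)
open import Relation.Binary.PropositionalEquality using (_≡_; _≢_)
open import Relation.Nullary using (¬_)
open import Algebra.Bundles using (CommutativeRing)

-- Polynomials over ℚ as coefficient lists (lowest degree first).

Polyℚ : Set
Polyℚ = List ℚ

infixl 6 _+ₚ_
infixl 7 _*ₚ_
infix 4 _≈ₚ_

_+ₚ_ : Polyℚ → Polyℚ → Polyℚ
[] +ₚ q = q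
(a ∷ p) +ₚ [] = a ∷ p
(a ∷ p) +ₚ (b ∷ q) = (a ℚ.+ b) ∷ (p +ₚ q)

_*ₚ_ : Polyℚ → Polyℚ → Polyℚ
[] *ₚ q = []
(a ∷ p) *ₚ q = map (a ℚ.*_) q +ₚ (0ℚ ∷ (p *ₚ q))

-- equality of polynomials (coefficientwise, trailing zeros ignored)
_≈ₚ_ : Polyℚ → Polyℚ → Set
[] ≈ₚ [] = Data.Unit.⊤ where import Data.Unit
[] ≈ₚ (b ∷ q) = (b ≡ 0ℚ) × ([] ≈ₚ q)
(a ∷ p) ≈ₚ [] = (a ≡ 0ℚ) × (p ≈ₚ [])
(a ∷ p) ≈ₚ (b ∷ q) = (a ≡ b) × (p ≈ₚ q)

IsUnitₚ : Polyℚ → Set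
IsUnitₚ p = Σ ℚ λ c → (c ≢ 0ℚ) × (p ≈ₚ (c ∷ []))

Irreducibleₚ : Polyℚ → Set
Irreducibleₚ p =
  (¬ (p ≈ₚ [])) × (¬ IsUnitₚ p) ×
  (∀ g h → g *ₚ h ≈ₚ p → IsUnitₚ g ⊎ IsUnitₚ h)

ℤ→ℚ : ℤ → ℚ
ℤ→ℚ n = n / 1

fPoly : ℤ → ℤ → ℤ → Polyℚ
fPoly a b c = u *ₚ u +ₚ (ℤ→ℚ b ∷ []) *ₚ u +ₚ (ℤ→ℚ c ∷ [])
  where
  u : Polyℚ
  u = 0ℚ ∷ ℤ→ℚ a ∷ 1ℚ ∷ []

module _ {c ℓ : Level} (K : CommutativeRing c ℓ) where
  open CommutativeRing K

  natK : ℕ → Carrier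
  natK zero = 0#
  natK (suc n) = 1# + natK n

  intK : ℤ → Carrier
  intK (+ n) = natK n
  intK -[1+ n ] = - natK (suc n)

  IsField : Set (c Level.⊔ ℓ)
  IsField = (¬ (1# ≈ 0#)) × (∀ x → ¬ (x ≈ 0#) → ∃ λ y → x * y ≈ 1#)

  CharZero : Set ℓ
  CharZero = ∀ n → natK n ≈ 0# → n ≡ 0

  InLR : Carrier → Carrier → Carrier → Carrier → Vec ℤ 5 → Set ℓ
  InLR α₁ α₂ α₃ α₄ (l₁ ∷ l₂ ∷ l₃ ∷ l₄ ∷ l₅ ∷ []) =
    intK l₁ * α₁ + intK l₂ * α₂ + intK l₃ * α₃ + intK l₄ * α₄ ≈ intK l₅

vecLin : ∀ {n} → ℤ → Vec ℤ n → ℤ → Vec ℤ n → Vec ℤ n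
vecLin m₁ v₁ m₂ v₂ = zipWith ℤ._+_ (Vec.map (m₁ ℤ.*_) v₁) (Vec.map (m₂ ℤ.*_) v₂)

relVec₁ relVec₂ : ℤ → Vec ℤ 5
relVec₁ a = + 1 ∷ + 1 ∷ + 0 ∷ + 0 ∷ ℤ.- a ∷ []
relVec₂ a = + 0 ∷ + 0 ∷ + 1 ∷ + 1 ∷ ℤ.- a ∷ []

zeroVec : Vec ℤ 5
zeroVec = Vec.replicate 5 (+ 0)

{-# OPTIONS --safe #-}
module Submission where

-- Eliminating α₁₂ = -a - α₁₁ and α₂₂ = -a - α₂₁ turns an integer relation into p α₁₁ + q α₂₁ = r
-- with p, q, r ∈ ℤ. If q ≠ 0 then α₂₁ = s + t α₁₁ with s, t ∈ ℚ, and substituting this into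
-- (α₁₁² + a α₁₁) + (α₂₁² + a α₂₁) = β₁ + β₂ = -b shows that α₁₁ satisfies a monic quadratic over ℚ;
-- if q = 0 ≠ p then α₁₁ is rational. Neither can happen to a root of the irreducible quartic f:
-- dividing f by the quadratic leaves a linear remainder vanishing at α₁₁, so either α₁₁ is rational
-- or the remainder is zero and f factors over ℚ, and a rational root also factors f.
-- Hence p = q = 0, so r = 0, and the relation is l₂ (1,1,0,0,-a) + l₄ (0,0,1,1,-a).

open import Defs
open import Level using (Level)
open import Data.Nat as ℕ using (ℕ; zero; suc)
open import Data.Integer as ℤ using (ℤ; +_; -[1+_])
import Data.Integer.Properties as ℤP
import Data.Nat.Properties as ℕP
open import Data.Sign as Sign using (Sign)
open import Data.Vec using (Vec)
open import Data.Product using (_×_; _,_; proj₁; proj₂; ∃₂)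
open import Data.Maybe using (Maybe; just; nothing)
open import Relation.Nullary using (¬_; Dec; yes; no)
open import Data.Empty using (⊥-elim)
open import Relation.Binary.PropositionalEquality as ≡ using (_≡_)
open import Algebra.Bundles using (CommutativeRing; RawRing)
import Algebra.Solver.Ring.AlmostCommutativeRing as ACR

module IntegerCoefficients {c ℓ : Level} (R : CommutativeRing c ℓ) where
  open CommutativeRing R
  open import Relation.Binary.Reasoning.Setoid setoid
  open import Algebra.Properties.Ring ring
    using (-0#≈0#; -‿involutive; -‿+-comm; -‿distribˡ-*; -‿distribʳ-*)

  natK-+ : ∀ m n → natK R (m ℕ.+ n) ≈ natK R m + natK R n
  natK-+ zero    n = sym (+-identityˡ _)
  natK-+ (suc m) n = trans (+-congˡ (natK-+ m n)) (sym (+-assoc _ _ _))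

  natK-* : ∀ m n → natK R (m ℕ.* n) ≈ natK R m * natK R n
  natK-* zero    n = sym (zeroˡ _)
  natK-* (suc m) n = begin
    natK R (n ℕ.+ m ℕ.* n)            ≈⟨ natK-+ n (m ℕ.* n) ⟩
    natK R n + natK R (m ℕ.* n)       ≈⟨ +-cong (sym (*-identityˡ _)) (natK-* m n) ⟩
    1# * natK R n + natK R m * natK R n ≈⟨ sym (distribʳ _ _ _) ⟩
    (1# + natK R m) * natK R n        ∎

  intK-⊖ : ∀ m n → intK R (m ℤ.⊖ n) ≈ natK R m + - natK R n
  intK-⊖ m zero = begin
    intK R (m ℤ.⊖ 0)    ≡⟨ ≡.cong (intK R) (ℤP.⊖-≥ {m} {0} ℕ.z≤n) ⟩
    natK R m            ≈⟨ sym (+-identityʳ _) ⟩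
    natK R m + 0#       ≈⟨ +-congˡ (sym -0#≈0#) ⟩
    natK R m + - 0#     ∎
  intK-⊖ zero (suc n) = begin
    intK R (0 ℤ.⊖ suc n) ≡⟨ ≡.cong (intK R) (ℤP.⊖-≤ {0} {suc n} ℕ.z≤n) ⟩
    - natK R (suc n)     ≈⟨ sym (+-identityˡ _) ⟩
    0# + - natK R (suc n) ∎
  intK-⊖ (suc m) (suc n) = begin
    intK R (suc m ℤ.⊖ suc n)            ≡⟨ ≡.cong (intK R) (ℤP.[1+m]⊖[1+n]≡m⊖n m n) ⟩
    intK R (m ℤ.⊖ n)                    ≈⟨ intK-⊖ m n ⟩
    natK R m + - natK R n               ≈⟨ sym (+-identityˡ _) ⟩
    0# + (natK R m + - natK R n)        ≈⟨ +-congʳ (sym (-‿inverseʳ 1#)) ⟩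
    (1# + - 1#) + (natK R m + - natK R n) ≈⟨ +-assoc _ _ _ ⟩
    1# + (- 1# + (natK R m + - natK R n)) ≈⟨ +-congˡ (trans (sym (+-assoc _ _ _))
                                             (trans (+-congʳ (+-comm _ _)) (+-assoc _ _ _))) ⟩
    1# + (natK R m + (- 1# + - natK R n)) ≈⟨ sym (+-assoc _ _ _) ⟩
    (1# + natK R m) + (- 1# + - natK R n) ≈⟨ +-congˡ (-‿+-comm 1# (natK R n)) ⟩
    (1# + natK R m) + - (1# + natK R n)   ∎

  intK-neg : ∀ i → intK R (ℤ.- i) ≈ - intK R i
  intK-neg (+ zero)  = sym -0#≈0#
  intK-neg (+ suc n) = refl
  intK-neg -[1+ n ]  = sym (-‿involutive _)

  intK-+ : ∀ i j → intK R (i ℤ.+ j) ≈ intK R i + intK R j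
  intK-+ -[1+ m ] -[1+ n ] = begin
    - natK R (suc (suc (m ℕ.+ n)))     ≡⟨ ≡.cong (λ k → - natK R k) (≡.sym (ℕP.+-suc (suc m) n)) ⟩
    - natK R (suc m ℕ.+ suc n)         ≈⟨ -‿cong (natK-+ (suc m) (suc n)) ⟩
    - (natK R (suc m) + natK R (suc n)) ≈⟨ sym (-‿+-comm _ _) ⟩
    - natK R (suc m) + - natK R (suc n) ∎
  intK-+ -[1+ m ] (+ n)    = trans (intK-⊖ n (suc m)) (+-comm _ _)
  intK-+ (+ m)    -[1+ n ] = intK-⊖ m (suc n)
  intK-+ (+ m)    (+ n)    = natK-+ m n

  signed : Sign → Carrier → Carrier
  signed Sign.+ x = x
  signed Sign.- x = - x

  intK-◃ : ∀ s n → intK R (s ℤ.◃ n) ≈ signed s (natK R n)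
  intK-◃ Sign.+ zero    = refl
  intK-◃ Sign.- zero    = sym -0#≈0#
  intK-◃ Sign.+ (suc n) = refl
  intK-◃ Sign.- (suc n) = refl

  intK-signAbs : ∀ i → intK R i ≈ signed (ℤ.sign i) (natK R ℤ.∣ i ∣)
  intK-signAbs (+ n)    = refl
  intK-signAbs -[1+ n ] = refl

  signed-cong : ∀ s {x y} → x ≈ y → signed s x ≈ signed s y
  signed-cong Sign.+ x≈y = x≈y
  signed-cong Sign.- x≈y = -‿cong x≈y

  signed-* : ∀ s t x y → signed (s Sign.* t) (x * y) ≈ signed s x * signed t y
  signed-* Sign.+ Sign.+ x y = refl
  signed-* Sign.+ Sign.- x y = -‿distribʳ-* x y
  signed-* Sign.- Sign.+ x y = -‿distribˡ-* x y
  signed-* Sign.- Sign.- x y = begin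
    x * y         ≈⟨ sym (-‿involutive _) ⟩
    - - (x * y)   ≈⟨ -‿cong (-‿distribˡ-* x y) ⟩
    - (- x * y)   ≈⟨ -‿distribʳ-* (- x) y ⟩
    - x * - y     ∎

  intK-* : ∀ i j → intK R (i ℤ.* j) ≈ intK R i * intK R j
  intK-* i j = begin
    intK R (i ℤ.* j)                                  ≈⟨ intK-◃ s (ℤ.∣ i ∣ ℕ.* ℤ.∣ j ∣) ⟩
    signed s (natK R (ℤ.∣ i ∣ ℕ.* ℤ.∣ j ∣))           ≈⟨ signed-cong s (natK-* ℤ.∣ i ∣ ℤ.∣ j ∣) ⟩
    signed s (natK R ℤ.∣ i ∣ * natK R ℤ.∣ j ∣)        ≈⟨ signed-* (ℤ.sign i) (ℤ.sign j) _ _ ⟩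
    signed (ℤ.sign i) (natK R ℤ.∣ i ∣) * signed (ℤ.sign j) (natK R ℤ.∣ j ∣)
                                                      ≈⟨ sym (*-cong (intK-signAbs i) (intK-signAbs j)) ⟩
    intK R i * intK R j                               ∎
    where s = ℤ.sign i Sign.* ℤ.sign j

  intK-morphism : ℤ.+-*-rawRing ACR.-Raw-AlmostCommutative⟶ ACR.fromCommutativeRing R
  intK-morphism = record
    { ⟦_⟧    = intK R
    ; +-homo = intK-+
    ; *-homo = intK-*
    ; -‿homo = intK-neg
    ; 0-homo = refl
    ; 1-homo = +-identityʳ 1#
    }

  intK-≈? : ∀ i j → Maybe (intK R i ≈ intK R j)
  intK-≈? i j with i ℤ.≟ j
  ... | yes ≡.refl = just refl
  ... | no _       = nothing

  open import Algebra.Solver.Ring ℤ.+-*-rawRing (ACR.fromCommutativeRing R) intK-morphism intK-≈? public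

  -- Formulas written over this raw ring are solver syntax for the same formulas in R.
  syntaxRawRing : ℕ → RawRing _ _
  syntaxRawRing n = record
    { Carrier = Polynomial n
    ; _≈_     = _≡_
    ; _+_     = _:+_
    ; _*_     = _:*_
    ; -_      = :-_
    ; 0#      = con (+ 0)
    ; 1#      = con (+ 1)
    }

module QuarticFormulas {c ℓ : Level} (R : RawRing c ℓ) where
  open RawRing R

  quartic : Carrier → Carrier → Carrier → Carrier → Carrier
  quartic A B C x = w * w + B * w + C
    where w = x * x + A * x

  -- quartic A B C x = (x² + β x + γ) (x² + quotient₁ x + quotient₀) + remainder₁ x + remainder₀
  quotient₁ : Carrier → Carrier → Carrier
  quotient₁ A β = A + A + - β

  quotient₀ : Carrier → Carrier → Carrier → Carrier → Carrier
  quotient₀ A B β γ = A * A + B + - γ + - (β * quotient₁ A β)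

  remainder₁ : Carrier → Carrier → Carrier → Carrier → Carrier
  remainder₁ A B β γ = A * B + - (β * quotient₀ A B β γ) + - (γ * quotient₁ A β)

  remainder₀ : Carrier → Carrier → Carrier → Carrier → Carrier → Carrier
  remainder₀ A B C β γ = C + - (γ * quotient₀ A B β γ)

  -- quartic A B C x = (x - ρ) (x³ + cofactor₂ x² + cofactor₁ x + cofactor₀) + quartic A B C ρ
  cofactor₂ : Carrier → Carrier → Carrier
  cofactor₂ A ρ = A + A + ρ

  cofactor₁ : Carrier → Carrier → Carrier → Carrier
  cofactor₁ A B ρ = A * A + B + ρ * cofactor₂ A ρ

  cofactor₀ : Carrier → Carrier → Carrier → Carrier
  cofactor₀ A B ρ = A * B + ρ * cofactor₁ A B ρ

  -- (x² + A x) + (y² + A y) + B with y = s + t x, collected by powers of x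
  relation₂ : Carrier → Carrier
  relation₂ t = 1# + t * t

  relation₁ : Carrier → Carrier → Carrier → Carrier
  relation₁ A s t = A + (s + s) * t + A * t

  relation₀ : Carrier → Carrier → Carrier → Carrier
  relation₀ A B s = s * s + A * s + B

module QuarticIdentities {c ℓ : Level} (R : CommutativeRing c ℓ) where
  open CommutativeRing R
  open import Relation.Binary.Reasoning.Setoid setoid
  open import Algebra.Properties.Ring ring using (-‿involutive)
  open import Algebra.Properties.Group +-group using (x≈z//y)
  open IntegerCoefficients R
  open QuarticFormulas rawRing
  module Syntax {n : ℕ} = QuarticFormulas (syntaxRawRing n)

  vieta-quadratic : ∀ {A β s t} → s + t ≈ - A → s * t ≈ - β → s * s + A * s ≈ β
  vieta-quadratic {A} {β} {s} {t} s+t≈-A st≈-β = begin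
    s * s + A * s         ≈⟨ +-congˡ (*-congʳ (sym (trans (-‿cong s+t≈-A) (-‿involutive A)))) ⟩
    s * s + - (s + t) * s ≈⟨ solve 2 (λ s t → s :* s :+ (:- (s :+ t)) :* s := :- (s :* t)) refl s t ⟩
    - (s * t)             ≈⟨ -‿cong st≈-β ⟩
    - - β                 ≈⟨ -‿involutive β ⟩
    β                     ∎

  quartic-vanishes : ∀ {A B C β₁ β₂ x} → x * x + A * x ≈ β₁ → β₁ + β₂ ≈ - B → β₁ * β₂ ≈ C →
                     quartic A B C x ≈ 0#
  quartic-vanishes {A} {B} {C} {β₁} {β₂} {x} w≈β₁ β₁+β₂≈-B β₁β₂≈C = begin
    quartic A B C x                           ≈⟨ +-cong (+-cong (*-cong w≈β₁ w≈β₁) (*-cong B≈ w≈β₁)) (sym β₁β₂≈C) ⟩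
    β₁ * β₁ + - (β₁ + β₂) * β₁ + β₁ * β₂       ≈⟨ solve 2 (λ p q → p :* p :+ (:- (p :+ q)) :* p :+ p :* q := con (+ 0))
                                                   refl β₁ β₂ ⟩
    0#                                        ∎
    where
    B≈ : B ≈ - (β₁ + β₂)
    B≈ = sym (trans (-‿cong β₁+β₂≈-B) (-‿involutive B))

  quartic-division : ∀ A B C β γ x →
    quartic A B C x ≈ (x * x + β * x + γ) * (x * x + quotient₁ A β * x + quotient₀ A B β γ)
                      + (remainder₁ A B β γ * x + remainder₀ A B C β γ)
  quartic-division = solve 6 (λ A B C β γ x →
    Syntax.quartic A B C x := (x :* x :+ β :* x :+ γ) :* (x :* x :+ Syntax.quotient₁ A β :* x :+ Syntax.quotient₀ A B β γ)
                              :+ (Syntax.remainder₁ A B β γ :* x :+ Syntax.remainder₀ A B C β γ)) refl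

  quartic-congʳ : ∀ A B C {x y} → x ≈ y → quartic A B C x ≈ quartic A B C y
  quartic-congʳ A B C x≈y = +-congʳ (+-cong (*-cong w≈ w≈) (*-congˡ w≈))
    where w≈ = +-cong (*-cong x≈y x≈y) (*-congˡ x≈y)

  eliminate-conjugates : ∀ {A x x′ y y′ l₁ l₂ l₃ l₄ l₅} → x + x′ ≈ - A → y + y′ ≈ - A →
    l₁ * x + l₂ * x′ + l₃ * y + l₄ * y′ ≈ l₅ →
    (l₁ + - l₂) * x + (l₃ + - l₄) * y ≈ l₅ + A * (l₂ + l₄)
  eliminate-conjugates {A} {x} {x′} {y} {y′} {l₁} {l₂} {l₃} {l₄} {l₅} hx hy relation = begin
    (l₁ + - l₂) * x + (l₃ + - l₄) * y
      ≈⟨ solve 7 (λ A x y l₁ l₂ l₃ l₄ →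
           (l₁ :+ :- l₂) :* x :+ (l₃ :+ :- l₄) :* y
           := l₁ :* x :+ l₂ :* (:- A :+ :- x) :+ l₃ :* y :+ l₄ :* (:- A :+ :- y) :+ A :* (l₂ :+ l₄))
           refl A x y l₁ l₂ l₃ l₄ ⟩
    l₁ * x + l₂ * (- A + - x) + l₃ * y + l₄ * (- A + - y) + A * (l₂ + l₄)
      ≈⟨ +-congʳ (+-cong (+-congʳ (+-congˡ (*-congˡ (sym (conjugate hx)))))
                               (*-congˡ (sym (conjugate hy)))) ⟩
    l₁ * x + l₂ * x′ + l₃ * y + l₄ * y′ + A * (l₂ + l₄)
      ≈⟨ +-congʳ relation ⟩
    l₅ + A * (l₂ + l₄) ∎
    where
    conjugate : ∀ {z z′} → z + z′ ≈ - A → z′ ≈ - A + - z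
    conjugate {z} {z′} z+z′≈-A = x≈z//y z′ z (- A) (trans (+-comm z′ z) z+z′≈-A)

  relVec₁∈LR : ∀ a {x x′ y y′} → x + x′ ≈ - intK R a → InLR R x x′ y y′ (relVec₁ a)
  relVec₁∈LR a {x} {x′} {y} {y′} x+x′≈-a =
    trans (solve 4 (λ x x′ y y′ → con (+ 1) :* x :+ con (+ 1) :* x′ :+ con (+ 0) :* y :+ con (+ 0) :* y′ := x :+ x′)
                   refl x x′ y y′)
          (trans x+x′≈-a (sym (intK-neg a)))

  relVec₂∈LR : ∀ a {x x′ y y′} → y + y′ ≈ - intK R a → InLR R x x′ y y′ (relVec₂ a)
  relVec₂∈LR a {x} {x′} {y} {y′} y+y′≈-a =
    trans (solve 4 (λ x x′ y y′ → con (+ 0) :* x :+ con (+ 0) :* x′ :+ con (+ 1) :* y :+ con (+ 1) :* y′ := y :+ y′)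
                   refl x x′ y y′)
          (trans y+y′≈-a (sym (intK-neg a)))

  linear-relation⇒quadratic : ∀ {A B β₁ β₂ s t x y} →
    x * x + A * x ≈ β₁ → y * y + A * y ≈ β₂ → β₁ + β₂ ≈ - B → y ≈ s + t * x →
    relation₂ t * (x * x) + relation₁ A s t * x + relation₀ A B s ≈ 0#
  linear-relation⇒quadratic {A} {B} {β₁} {β₂} {s} {t} {x} {y} wx wy β₁+β₂≈-B y≈ = begin
    (1# + t * t) * (x * x) + relation₁ A s t * x + relation₀ A B s
      ≈⟨ +-congʳ (+-congʳ (trans (distribʳ _ _ _) (+-congʳ (*-identityˡ _)))) ⟩
    x * x + t * t * (x * x) + relation₁ A s t * x + relation₀ A B s
      ≈⟨ solve 7 (λ A B s t x b₁ b₂ → let y = s :+ t :* x in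
           x :* x :+ t :* t :* (x :* x) :+ (A :+ (s :+ s) :* t :+ A :* t) :* x :+ (s :* s :+ A :* s :+ B)
           := (x :* x :+ A :* x :+ :- b₁) :+ (y :* y :+ A :* y :+ :- b₂) :+ (b₁ :+ b₂ :+ B))
           refl A B s t x β₁ β₂ ⟩
    (x * x + A * x + - β₁) + (y′ * y′ + A * y′ + - β₂) + (β₁ + β₂ + B)
      ≈⟨ +-cong (+-cong (+-congʳ wx) (+-congʳ (trans (+-cong (*-cong (sym y≈) (sym y≈)) (*-congˡ (sym y≈))) wy)))
                (+-congʳ β₁+β₂≈-B) ⟩
    (β₁ + - β₁) + (β₂ + - β₂) + (- B + B)
      ≈⟨ solve 3 (λ p q b → (p :+ :- p) :+ (q :+ :- q) :+ (:- b :+ b) := con (+ 0)) refl β₁ β₂ B ⟩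
    0# ∎
    where y′ = s + t * x

module RationalFactorisations where
  open import Data.Rational as ℚ using (0ℚ; 1ℚ)
  import Data.Rational.Properties as ℚP
  open import Data.List using ([]; _∷_; _++_)
  open import Data.Sum using ([_,_]′)
  open IntegerCoefficients ℚP.+-*-commutativeRing
  open QuarticFormulas (CommutativeRing.rawRing ℚP.+-*-commutativeRing)
  module Syntax {n : ℕ} = QuarticFormulas (syntaxRawRing n)

  monic-nonzero : ∀ p → ¬ (p ++ 1ℚ ∷ [] ≈ₚ [])
  monic-nonzero []      (() , _)
  monic-nonzero (x ∷ p) (_ , p≈0) = monic-nonzero p p≈0

  nonconstant-monic-nonunit : ∀ x p → ¬ IsUnitₚ (x ∷ p ++ 1ℚ ∷ [])
  nonconstant-monic-nonunit x p (_ , _ , _ , p≈0) = monic-nonzero p p≈0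

  factors⇒reducible : ∀ {f} g h → g *ₚ h ≈ₚ f → ¬ IsUnitₚ g → ¬ IsUnitₚ h → ¬ Irreducibleₚ f
  factors⇒reducible g h gh≈f g-nonunit h-nonunit (_ , _ , irreducible) =
    [ g-nonunit , h-nonunit ]′ (irreducible g h gh≈f)

  private
    minus-zero : ∀ {x y v} → x ≡ y ℚ.+ ℚ.- v → v ≡ 0ℚ → x ≡ y
    minus-zero {y = y} x≡y-v ≡.refl = ≡.trans x≡y-v (ℚP.+-identityʳ y)

    O L : ∀ {n} → Polynomial n
    O = con (+ 0)
    L = con (+ 1)

  -- The right-hand sides below are the coefficients of fPoly a b c exactly as _*ₚ_ and _+ₚ_ compute them.
  module _ (a b c : ℤ) where
    private
      A = ℤ→ℚ a
      B = ℤ→ℚ b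
      C = ℤ→ℚ c

    fPoly-linear-factorisation : ∀ ρ → quartic A B C ρ ≡ 0ℚ →
      (ℚ.- ρ ∷ 1ℚ ∷ []) *ₚ (cofactor₀ A B ρ ∷ cofactor₁ A B ρ ∷ cofactor₂ A ρ ∷ 1ℚ ∷ []) ≈ₚ fPoly a b c
    fPoly-linear-factorisation ρ f[ρ]≡0 =
        minus-zero (solve 4 (λ A B C ρ → (:- ρ) :* Syntax.cofactor₀ A B ρ :+ O
                               := O :+ (B :* O :+ O) :+ C :+ :- Syntax.quartic A B C ρ) ≡.refl A B C ρ) f[ρ]≡0
      , solve 3 (λ A B ρ → (:- ρ) :* Syntax.cofactor₁ A B ρ :+ (L :* Syntax.cofactor₀ A B ρ :+ O)
                   := O :* A :+ (A :* O :+ O) :+ B :* A) ≡.refl A B ρ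
      , solve 3 (λ A B ρ → (:- ρ) :* Syntax.cofactor₂ A ρ :+ L :* Syntax.cofactor₁ A B ρ
                   := O :+ (A :* A :+ O) :+ B :* L) ≡.refl A B ρ
      , solve 2 (λ A ρ → (:- ρ) :* L :+ L :* Syntax.cofactor₂ A ρ := A :* L :+ L :* A) ≡.refl A ρ
      , ≡.refl , _

    fPoly-quadratic-factorisation : ∀ β γ → remainder₁ A B β γ ≡ 0ℚ → remainder₀ A B C β γ ≡ 0ℚ →
      (γ ∷ β ∷ 1ℚ ∷ []) *ₚ (quotient₀ A B β γ ∷ quotient₁ A β ∷ 1ℚ ∷ []) ≈ₚ fPoly a b c
    fPoly-quadratic-factorisation β γ r₁≡0 r₀≡0 =
        minus-zero (solve 5 (λ A B C β γ → γ :* Syntax.quotient₀ A B β γ :+ O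
                               := O :+ (B :* O :+ O) :+ C :+ :- Syntax.remainder₀ A B C β γ) ≡.refl A B C β γ) r₀≡0
      , minus-zero (solve 4 (λ A B β γ → γ :* Syntax.quotient₁ A β :+ (β :* Syntax.quotient₀ A B β γ :+ O)
                               := O :* A :+ (A :* O :+ O) :+ B :* A :+ :- Syntax.remainder₁ A B β γ) ≡.refl A B β γ) r₁≡0
      , solve 4 (λ A B β γ → γ :* L :+ (β :* Syntax.quotient₁ A β :+ (L :* Syntax.quotient₀ A B β γ :+ O))
                   := O :+ (A :* A :+ O) :+ B :* L) ≡.refl A B β γ
      , solve 2 (λ A β → β :* L :+ L :* Syntax.quotient₁ A β := A :* L :+ L :* A) ≡.refl A β
      , ≡.refl , _

    rational-root⇒reducible : ∀ ρ → quartic A B C ρ ≡ 0ℚ → ¬ Irreducibleₚ (fPoly a b c)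
    rational-root⇒reducible ρ f[ρ]≡0 =
      factors⇒reducible (ℚ.- ρ ∷ 1ℚ ∷ []) (cofactor₀ A B ρ ∷ cofactor₁ A B ρ ∷ cofactor₂ A ρ ∷ 1ℚ ∷ [])
        (fPoly-linear-factorisation ρ f[ρ]≡0)
        (nonconstant-monic-nonunit (ℚ.- ρ) [])
        (nonconstant-monic-nonunit (cofactor₀ A B ρ) (cofactor₁ A B ρ ∷ cofactor₂ A ρ ∷ []))

    rational-quadratic-divisor⇒reducible : ∀ β γ → remainder₁ A B β γ ≡ 0ℚ → remainder₀ A B C β γ ≡ 0ℚ →
                                           ¬ Irreducibleₚ (fPoly a b c)
    rational-quadratic-divisor⇒reducible β γ r₁≡0 r₀≡0 =
      factors⇒reducible (γ ∷ β ∷ 1ℚ ∷ []) (quotient₀ A B β γ ∷ quotient₁ A β ∷ 1ℚ ∷ [])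
        (fPoly-quadratic-factorisation β γ r₁≡0 r₀≡0)
        (nonconstant-monic-nonunit γ (β ∷ []))
        (nonconstant-monic-nonunit (quotient₀ A B β γ) (quotient₁ A β ∷ []))

module RationalSquares where
  open import Data.Rational as ℚ using (0ℚ; 1ℚ)
  import Data.Rational.Properties as ℚP
  open import Data.Sum using (inj₁; inj₂)
  open IntegerCoefficients ℚP.+-*-commutativeRing

  square-nonNegative : ∀ t → ℚ.NonNegative (t ℚ.* t)
  square-nonNegative t with ℚP.≤-total 0ℚ t
  ... | inj₁ 0≤t = ℚP.nonNeg*nonNeg⇒nonNeg t t
    where instance _ = ℚ.nonNegative 0≤t
  ... | inj₂ t≤0 = ≡.subst ℚ.NonNegative (solve 1 (λ t → (:- t) :* (:- t) := t :* t) ≡.refl t)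
                          (ℚP.nonNeg*nonNeg⇒nonNeg (ℚ.- t) (ℚ.- t))
    where instance _ = ℚ.nonNegative (ℚP.neg-antimono-≤ t≤0)

  one-plus-square-nonZero : ∀ t → ℚ.NonZero (1ℚ ℚ.+ t ℚ.* t)
  one-plus-square-nonZero t =
    ℚP.pos⇒nonZero (1ℚ ℚ.+ t ℚ.* t) {{ℚP.pos+nonNeg⇒pos 1ℚ (t ℚ.* t) {{square-nonNegative t}}}}

module RationalEmbedding {k ℓ : Level} (K : CommutativeRing k ℓ) (isField : IsField K) (charZero : CharZero K) where
  open CommutativeRing K
  open import Relation.Binary.Reasoning.Setoid setoid
  open import Algebra.Properties.Ring ring using (-0#≈0#; -‿involutive; -‿distribˡ-*)
  open import Data.Rational as ℚ using (ℚ; mkℚ; 0ℚ; 1ℚ)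
  open import Data.Rational.Unnormalised as ℚᵘ using (ℚᵘ; mkℚᵘ)
  import Data.Rational.Properties as ℚP
  open IntegerCoefficients K

  natK-suc≉0 : ∀ d → natK K (suc d) ≉ 0#
  natK-suc≉0 d 1+d≈0 = ℕP.1+n≢0 (charZero (suc d) 1+d≈0)

  intK≈0⇒≡0 : ∀ i → intK K i ≈ 0# → i ≡ + 0
  intK≈0⇒≡0 (+ n)    n≈0  = ≡.cong +_ (charZero n n≈0)
  intK≈0⇒≡0 -[1+ n ] -n≈0 = ⊥-elim (natK-suc≉0 n (begin
    natK K (suc n)     ≈⟨ sym (-‿involutive _) ⟩
    - - natK K (suc n) ≈⟨ -‿cong -n≈0 ⟩
    - 0#               ≈⟨ -0#≈0# ⟩
    0#                 ∎))

  inverse-unique : ∀ {x y z} → x * y ≈ 1# → x * z ≈ 1# → y ≈ z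
  inverse-unique {x} {y} {z} xy≈1 xz≈1 = begin
    y             ≈⟨ sym (*-identityʳ y) ⟩
    y * 1#        ≈⟨ *-congˡ (sym xz≈1) ⟩
    y * (x * z)   ≈⟨ sym (*-assoc y x z) ⟩
    (y * x) * z   ≈⟨ *-congʳ (trans (*-comm y x) xy≈1) ⟩
    1# * z        ≈⟨ *-identityˡ z ⟩
    z             ∎

  recip : ℕ → Carrier
  recip d = proj₁ (proj₂ isField (natK K (suc d)) (natK-suc≉0 d))

  recip-inverse : ∀ d → natK K (suc d) * recip d ≈ 1#
  recip-inverse d = proj₂ (proj₂ isField (natK K (suc d)) (natK-suc≉0 d))

  cancel-recip : ∀ x d → x * (natK K (suc d) * recip d) ≈ x
  cancel-recip x d = trans (*-congˡ (recip-inverse d)) (*-identityʳ x)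

  recip-0 : recip 0 ≈ 1#
  recip-0 = inverse-unique (recip-inverse 0) (trans (*-identityʳ _) (+-identityʳ 1#))

  recip-* : ∀ d₁ d₂ → recip (d₂ ℕ.+ d₁ ℕ.* suc d₂) ≈ recip d₁ * recip d₂
  recip-* d₁ d₂ = inverse-unique (recip-inverse (d₂ ℕ.+ d₁ ℕ.* suc d₂)) (begin
    natK K (suc d₁ ℕ.* suc d₂) * (recip d₁ * recip d₂)
      ≈⟨ *-congʳ (natK-* (suc d₁) (suc d₂)) ⟩
    (natK K (suc d₁) * natK K (suc d₂)) * (recip d₁ * recip d₂)
      ≈⟨ solve 4 (λ a b c d → (a :* b) :* (c :* d) := (a :* c) :* (b :* d)) refl _ _ _ _ ⟩
    (natK K (suc d₁) * recip d₁) * (natK K (suc d₂) * recip d₂)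
      ≈⟨ *-cong (recip-inverse d₁) (recip-inverse d₂) ⟩
    1# * 1#
      ≈⟨ *-identityʳ 1# ⟩
    1# ∎)

  -- mkℚᵘ n d stands for n / (1 + d)
  φᵘ : ℚᵘ → Carrier
  φᵘ (mkℚᵘ n d) = intK K n * recip d

  φᵘ-cong : ∀ p q → p ℚᵘ.≃ q → φᵘ p ≈ φᵘ q
  φᵘ-cong (mkℚᵘ n₁ d₁) (mkℚᵘ n₂ d₂) (ℚᵘ.*≡* n₁[1+d₂]≡n₂[1+d₁]) = begin
    intK K n₁ * recip d₁
      ≈⟨ sym (cancel-recip _ d₂) ⟩
    intK K n₁ * recip d₁ * (natK K (suc d₂) * recip d₂)
      ≈⟨ solve 4 (λ a b c d → a :* b :* (c :* d) := (a :* c) :* (b :* d)) refl _ _ _ _ ⟩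
    (intK K n₁ * natK K (suc d₂)) * (recip d₁ * recip d₂)
      ≈⟨ *-congʳ (sym (intK-* n₁ (+ suc d₂))) ⟩
    intK K (n₁ ℤ.* + suc d₂) * (recip d₁ * recip d₂)
      ≡⟨ ≡.cong (λ m → intK K m * (recip d₁ * recip d₂)) n₁[1+d₂]≡n₂[1+d₁] ⟩
    intK K (n₂ ℤ.* + suc d₁) * (recip d₁ * recip d₂)
      ≈⟨ *-congʳ (intK-* n₂ (+ suc d₁)) ⟩
    (intK K n₂ * natK K (suc d₁)) * (recip d₁ * recip d₂)
      ≈⟨ solve 4 (λ a b c d → (a :* c) :* (b :* d) := a :* d :* (c :* b)) refl _ _ _ _ ⟩
    intK K n₂ * recip d₂ * (natK K (suc d₁) * recip d₁)
      ≈⟨ cancel-recip _ d₁ ⟩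
    intK K n₂ * recip d₂ ∎

  φᵘ-+ : ∀ p q → φᵘ (p ℚᵘ.+ q) ≈ φᵘ p + φᵘ q
  φᵘ-+ (mkℚᵘ n₁ d₁) (mkℚᵘ n₂ d₂) = begin
    intK K (n₁ ℤ.* + suc d₂ ℤ.+ n₂ ℤ.* + suc d₁) * recip (d₂ ℕ.+ d₁ ℕ.* suc d₂)
      ≈⟨ *-cong (trans (intK-+ (n₁ ℤ.* + suc d₂) (n₂ ℤ.* + suc d₁))
                       (+-cong (intK-* n₁ (+ suc d₂)) (intK-* n₂ (+ suc d₁))))
                (recip-* d₁ d₂) ⟩
    (intK K n₁ * natK K (suc d₂) + intK K n₂ * natK K (suc d₁)) * (recip d₁ * recip d₂)
      ≈⟨ solve 6 (λ a b c d e f → (a :* c :+ b :* d) :* (e :* f) := a :* e :* (c :* f) :+ b :* f :* (d :* e))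
                 refl _ _ _ _ _ _ ⟩
    intK K n₁ * recip d₁ * (natK K (suc d₂) * recip d₂) + intK K n₂ * recip d₂ * (natK K (suc d₁) * recip d₁)
      ≈⟨ +-cong (cancel-recip _ d₂) (cancel-recip _ d₁) ⟩
    intK K n₁ * recip d₁ + intK K n₂ * recip d₂ ∎

  φᵘ-* : ∀ p q → φᵘ (p ℚᵘ.* q) ≈ φᵘ p * φᵘ q
  φᵘ-* (mkℚᵘ n₁ d₁) (mkℚᵘ n₂ d₂) = begin
    intK K (n₁ ℤ.* n₂) * recip (d₂ ℕ.+ d₁ ℕ.* suc d₂) ≈⟨ *-cong (intK-* n₁ n₂) (recip-* d₁ d₂) ⟩
    (intK K n₁ * intK K n₂) * (recip d₁ * recip d₂)   ≈⟨ solve 4 (λ a b c d → (a :* b) :* (c :* d) := (a :* c) :* (b :* d))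
                                                            refl _ _ _ _ ⟩
    intK K n₁ * recip d₁ * (intK K n₂ * recip d₂)     ∎

  φᵘ-neg : ∀ p → φᵘ (ℚᵘ.- p) ≈ - φᵘ p
  φᵘ-neg (mkℚᵘ n d) = trans (*-congʳ (intK-neg n)) (sym (-‿distribˡ-* _ _))

  -- Opaque, so that unifying φ ?p with φ q solves ?p := q, as the transport combinators below need.
  opaque
    φ : ℚ → Carrier
    φ p = φᵘ (ℚ.toℚᵘ p)

  opaque
    unfolding φ

    φ-+ : ∀ p q → φ (p ℚ.+ q) ≈ φ p + φ q
    φ-+ p q = trans (φᵘ-cong _ _ (ℚP.toℚᵘ-homo-+ p q)) (φᵘ-+ (ℚ.toℚᵘ p) (ℚ.toℚᵘ q))

    φ-* : ∀ p q → φ (p ℚ.* q) ≈ φ p * φ q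
    φ-* p q = trans (φᵘ-cong _ _ (ℚP.toℚᵘ-homo-* p q)) (φᵘ-* (ℚ.toℚᵘ p) (ℚ.toℚᵘ q))

    φ-neg : ∀ p → φ (ℚ.- p) ≈ - φ p
    φ-neg p = trans (φᵘ-cong _ _ (ℚP.toℚᵘ-homo‿- p)) (φᵘ-neg (ℚ.toℚᵘ p))

    φ-int : ∀ n → φ (ℤ→ℚ n) ≈ intK K n
    φ-int n = trans (φᵘ-cong _ _ (ℚP.toℚᵘ-fromℚᵘ (mkℚᵘ n 0))) (trans (*-congˡ recip-0) (*-identityʳ _))

    φ-injective : ∀ p → φ p ≈ 0# → p ≡ 0ℚ
    φ-injective p@(mkℚ n d _) φp≈0 = ℚP.↥p≡0⇒p≡0 p (intK≈0⇒≡0 n (begin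
      intK K n                                ≈⟨ sym (cancel-recip _ d) ⟩
      intK K n * (natK K (suc d) * recip d)   ≈⟨ solve 3 (λ a b c → a :* (b :* c) := (a :* c) :* b) refl _ _ _ ⟩
      (intK K n * recip d) * natK K (suc d)   ≈⟨ *-congʳ φp≈0 ⟩
      0# * natK K (suc d)                     ≈⟨ zeroˡ _ ⟩
      0#                                      ∎))

  φ-1 : φ 1ℚ ≈ 1#
  φ-1 = trans (φ-int (+ 1)) (+-identityʳ 1#)

  φ-0 : φ 0ℚ ≈ 0#
  φ-0 = φ-int (+ 0)

  ≡0⇒φ≈0 : ∀ {q} → q ≡ 0ℚ → φ q ≈ 0#
  ≡0⇒φ≈0 q≡0 = trans (reflexive (≡.cong φ q≡0)) φ-0

  φ-inverse : ∀ p .{{_ : ℚ.NonZero p}} → φ p * φ (ℚ.1/ p) ≈ 1#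
  φ-inverse p = trans (sym (φ-* p (ℚ.1/ p))) (trans (reflexive (≡.cong φ (ℚP.*-inverseʳ p))) φ-1)

  rational-linear-solution : ∀ u {x z} .{{_ : ℚ.NonZero u}} → φ u * x ≈ z → x ≈ φ (ℚ.1/ u) * z
  rational-linear-solution u {x} {z} ux≈z = begin
    x                         ≈⟨ sym (trans (*-congˡ (φ-inverse u)) (*-identityʳ x)) ⟩
    x * (φ u * φ (ℚ.1/ u))    ≈⟨ solve 3 (λ x a b → x :* (a :* b) := b :* (a :* x)) refl x (φ u) (φ (ℚ.1/ u)) ⟩
    φ (ℚ.1/ u) * (φ u * x)    ≈⟨ *-congˡ ux≈z ⟩
    φ (ℚ.1/ u) * z            ∎

  ℤ→ℚ≡0⇒≡0 : ∀ i → ℤ→ℚ i ≡ 0ℚ → i ≡ + 0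
  ℤ→ℚ≡0⇒≡0 i i≡0 = intK≈0⇒≡0 i (trans (sym (φ-int i)) (≡0⇒φ≈0 i≡0))

  monic-rational-quadratic : ∀ λ₂ λ₁ λ₀ x .{{_ : ℚ.NonZero λ₂}} →
    φ λ₂ * (x * x) + φ λ₁ * x + φ λ₀ ≈ 0# →
    x * x + φ (λ₁ ℚ.* ℚ.1/ λ₂) * x + φ (λ₀ ℚ.* ℚ.1/ λ₂) ≈ 0#
  monic-rational-quadratic λ₂ λ₁ λ₀ x quadratic≈0 = begin
    x * x + φ (λ₁ ℚ.* ℚ.1/ λ₂) * x + φ (λ₀ ℚ.* ℚ.1/ λ₂)
      ≈⟨ +-cong (+-cong (sym (trans (*-congˡ (φ-inverse λ₂)) (*-identityʳ _))) (*-congʳ (φ-* λ₁ (ℚ.1/ λ₂))))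
                (φ-* λ₀ (ℚ.1/ λ₂)) ⟩
    x * x * (φ λ₂ * μ) + φ λ₁ * μ * x + φ λ₀ * μ
      ≈⟨ solve 5 (λ x a b c m → x :* x :* (a :* m) :+ b :* m :* x :+ c :* m := m :* (a :* (x :* x) :+ b :* x :+ c))
                 refl x (φ λ₂) (φ λ₁) (φ λ₀) μ ⟩
    μ * (φ λ₂ * (x * x) + φ λ₁ * x + φ λ₀)
      ≈⟨ *-congˡ quadratic≈0 ⟩
    μ * 0#
      ≈⟨ zeroʳ μ ⟩
    0# ∎
    where μ = φ (ℚ.1/ λ₂)

  module ℚFormulas = QuarticFormulas (CommutativeRing.rawRing ℚP.+-*-commutativeRing)
  open QuarticFormulas rawRing

  private
    infixl 6 _⊕_
    infixl 7 _⊛_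
    infix  8 ⊝_

    _⊕_ : ∀ {p q x y} → φ p ≈ x → φ q ≈ y → φ (p ℚ.+ q) ≈ x + y
    _⊕_ {p} {q} φp≈x φq≈y = trans (φ-+ p q) (+-cong φp≈x φq≈y)

    _⊛_ : ∀ {p q x y} → φ p ≈ x → φ q ≈ y → φ (p ℚ.* q) ≈ x * y
    _⊛_ {p} {q} φp≈x φq≈y = trans (φ-* p q) (*-cong φp≈x φq≈y)

    ⊝_ : ∀ {p x} → φ p ≈ x → φ (ℚ.- p) ≈ - x
    ⊝_ {p} φp≈x = trans (φ-neg p) (-‿cong φp≈x)

  φ-quartic : ∀ A B C x → φ (ℚFormulas.quartic A B C x) ≈ quartic (φ A) (φ B) (φ C) (φ x)
  φ-quartic A B C x = φw ⊛ φw ⊕ refl ⊛ φw ⊕ refl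
    where φw = refl ⊛ refl ⊕ refl ⊛ refl

  φ-quotient₁ : ∀ A β → φ (ℚFormulas.quotient₁ A β) ≈ quotient₁ (φ A) (φ β)
  φ-quotient₁ A β = refl ⊕ refl ⊕ ⊝ refl

  φ-quotient₀ : ∀ A B β γ → φ (ℚFormulas.quotient₀ A B β γ) ≈ quotient₀ (φ A) (φ B) (φ β) (φ γ)
  φ-quotient₀ A B β γ = refl ⊛ refl ⊕ refl ⊕ ⊝ refl ⊕ ⊝ (refl ⊛ φ-quotient₁ A β)

  φ-remainder₁ : ∀ A B β γ → φ (ℚFormulas.remainder₁ A B β γ) ≈ remainder₁ (φ A) (φ B) (φ β) (φ γ)
  φ-remainder₁ A B β γ = refl ⊛ refl ⊕ ⊝ (refl ⊛ φ-quotient₀ A B β γ) ⊕ ⊝ (refl ⊛ φ-quotient₁ A β)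

  φ-remainder₀ : ∀ A B C β γ → φ (ℚFormulas.remainder₀ A B C β γ) ≈ remainder₀ (φ A) (φ B) (φ C) (φ β) (φ γ)
  φ-remainder₀ A B C β γ = refl ⊕ ⊝ (refl ⊛ φ-quotient₀ A B β γ)

  φ-relation₂ : ∀ t → φ (ℚFormulas.relation₂ t) ≈ relation₂ (φ t)
  φ-relation₂ t = φ-1 ⊕ refl ⊛ refl

  φ-relation₁ : ∀ A s t → φ (ℚFormulas.relation₁ A s t) ≈ relation₁ (φ A) (φ s) (φ t)
  φ-relation₁ A s t = refl ⊕ (refl ⊕ refl) ⊛ refl ⊕ refl ⊛ refl

  φ-relation₀ : ∀ A B s → φ (ℚFormulas.relation₀ A B s) ≈ relation₀ (φ A) (φ B) (φ s)
  φ-relation₀ A B s = refl ⊛ refl ⊕ refl ⊛ refl ⊕ refl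

module RelationVectors where
  open import Data.Vec using ([]; _∷_)
  open import Data.Vec.Properties using (∷-injectiveˡ; ∷-injectiveʳ)
  open import Data.Integer.Tactic.RingSolver using (solve-∀)

  vecLin-relVecs : ∀ a m₁ m₂ →
    vecLin m₁ (relVec₁ a) m₂ (relVec₂ a) ≡ m₁ ∷ m₁ ∷ m₂ ∷ m₂ ∷ ℤ.- (a ℤ.* (m₁ ℤ.+ m₂)) ∷ []
  vecLin-relVecs a m₁ m₂ =
    ≡.trans (≡.cong₂ (λ u v → u ∷ u ∷ v ∷ v ∷ m₁ ℤ.* ℤ.- a ℤ.+ m₂ ℤ.* ℤ.- a ∷ []) (first m₁ m₂) (second m₁ m₂))
            (≡.cong (λ w → m₁ ∷ m₁ ∷ m₂ ∷ m₂ ∷ w ∷ []) (last a m₁ m₂))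
    where
    first : ∀ m₁ m₂ → m₁ ℤ.* + 1 ℤ.+ m₂ ℤ.* + 0 ≡ m₁
    first = solve-∀
    second : ∀ m₁ m₂ → m₁ ℤ.* + 0 ℤ.+ m₂ ℤ.* + 1 ≡ m₂
    second = solve-∀
    last : ∀ a m₁ m₂ → m₁ ℤ.* ℤ.- a ℤ.+ m₂ ℤ.* ℤ.- a ≡ ℤ.- (a ℤ.* (m₁ ℤ.+ m₂))
    last = solve-∀

  relVecs-independent : ∀ a m₁ m₂ → vecLin m₁ (relVec₁ a) m₂ (relVec₂ a) ≡ zeroVec → (m₁ ≡ + 0) × (m₂ ≡ + 0)
  relVecs-independent a m₁ m₂ combination≡0 = ∷-injectiveˡ components≡0 , ∷-injectiveˡ (∷-injectiveʳ (∷-injectiveʳ components≡0))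
    where components≡0 = ≡.trans (≡.sym (vecLin-relVecs a m₁ m₂)) combination≡0

  relVecs-span : ∀ a l₁ l₂ l₃ l₄ l₅ → l₁ ≡ l₂ → l₃ ≡ l₄ → l₅ ≡ ℤ.- (a ℤ.* (l₂ ℤ.+ l₄)) →
                 l₁ ∷ l₂ ∷ l₃ ∷ l₄ ∷ l₅ ∷ [] ≡ vecLin l₂ (relVec₁ a) l₄ (relVec₂ a)
  relVecs-span a _ l₂ _ l₄ _ ≡.refl ≡.refl ≡.refl = ≡.sym (vecLin-relVecs a l₂ l₄)

module QuarticRoots {k ℓ : Level} (K : CommutativeRing k ℓ) (isField : IsField K) (charZero : CharZero K)
                    (a b c : ℤ) (irreducible : Irreducibleₚ (fPoly a b c)) where
  open CommutativeRing K
  open import Relation.Binary.Reasoning.Setoid setoid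
  open import Data.Rational as ℚ using (ℚ; 0ℚ)
  open import Data.Vec using ([]; _∷_)
  open import Algebra.Properties.Group +-group using (x≈z//y; inverseˡ-unique)
  open IntegerCoefficients K
  open QuarticFormulas rawRing
  open QuarticIdentities K
  open RationalEmbedding K isField charZero
  open RationalFactorisations using (rational-root⇒reducible; rational-quadratic-divisor⇒reducible)
  open RationalSquares using (one-plus-square-nonZero)
  open RelationVectors using (relVecs-span)

  Â B̂ Ĉ : ℚ
  Â = ℤ→ℚ a
  B̂ = ℤ→ℚ b
  Ĉ = ℤ→ℚ c

  A B C : Carrier
  A = φ Â
  B = φ B̂
  C = φ Ĉ

  rational-root-impossible : ∀ ρ → ¬ (quartic A B C (φ ρ) ≈ 0#)
  rational-root-impossible ρ f[ρ]≈0 =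
    rational-root⇒reducible a b c ρ (φ-injective _ (trans (φ-quartic Â B̂ Ĉ ρ) f[ρ]≈0)) irreducible

  remainder-vanishes : ∀ β γ x → x * x + φ β * x + φ γ ≈ 0# → quartic A B C x ≈ 0# →
    φ (ℚFormulas.remainder₁ Â B̂ β γ) * x + φ (ℚFormulas.remainder₀ Â B̂ Ĉ β γ) ≈ 0#
  remainder-vanishes β γ x q[x]≈0 f[x]≈0 = begin
    φ (ℚFormulas.remainder₁ Â B̂ β γ) * x + φ (ℚFormulas.remainder₀ Â B̂ Ĉ β γ)
      ≈⟨ +-cong (*-congʳ (φ-remainder₁ Â B̂ β γ)) (φ-remainder₀ Â B̂ Ĉ β γ) ⟩
    remainder
      ≈⟨ solve 2 (λ h r → r := con (+ 0) :* h :+ r) refl quotient remainder ⟩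
    0# * quotient + remainder
      ≈⟨ +-congʳ (*-congʳ (sym q[x]≈0)) ⟩
    (x * x + φ β * x + φ γ) * quotient + remainder
      ≈⟨ sym (quartic-division A B C (φ β) (φ γ) x) ⟩
    quartic A B C x
      ≈⟨ f[x]≈0 ⟩
    0# ∎
    where
    quotient  = x * x + quotient₁ A (φ β) * x + quotient₀ A B (φ β) (φ γ)
    remainder = remainder₁ A B (φ β) (φ γ) * x + remainder₀ A B C (φ β) (φ γ)

  rational-quadratic-impossible : ∀ β γ x → x * x + φ β * x + φ γ ≈ 0# → ¬ (quartic A B C x ≈ 0#)
  rational-quadratic-impossible β γ x q[x]≈0 f[x]≈0 with ℚFormulas.remainder₁ Â B̂ β γ ℚ.≟ 0ℚ
  ... | yes r₁≡0 = rational-quadratic-divisor⇒reducible a b c β γ r₁≡0 (φ-injective r₀ φr₀≈0) irreducible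
    where
    r₀ = ℚFormulas.remainder₀ Â B̂ Ĉ β γ
    φr₀≈0 : φ r₀ ≈ 0#
    φr₀≈0 = begin
      φ r₀                         ≈⟨ sym (+-identityˡ _) ⟩
      0# + φ r₀                    ≈⟨ +-congʳ (sym (trans (*-congʳ (≡0⇒φ≈0 r₁≡0)) (zeroˡ x))) ⟩
      φ (ℚFormulas.remainder₁ Â B̂ β γ) * x + φ r₀ ≈⟨ remainder-vanishes β γ x q[x]≈0 f[x]≈0 ⟩
      0#                           ∎
  ... | no r₁≢0 = rational-root-impossible ρ (trans (quartic-congʳ A B C (sym x≈φρ)) f[x]≈0)
    where
    r₁ = ℚFormulas.remainder₁ Â B̂ β γ
    r₀ = ℚFormulas.remainder₀ Â B̂ Ĉ β γ
    instance _ = ℚ.≢-nonZero r₁≢0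
    ρ = ℚ.1/ r₁ ℚ.* ℚ.- r₀
    x≈φρ : x ≈ φ ρ
    x≈φρ = trans (rational-linear-solution r₁ (trans (inverseˡ-unique _ _ (remainder-vanishes β γ x q[x]≈0 f[x]≈0))
                                                    (sym (φ-neg r₀))))
                 (sym (φ-* (ℚ.1/ r₁) (ℚ.- r₀)))

  affine-relation-impossible : ∀ {β₁ β₂ x y} s t → x * x + A * x ≈ β₁ → y * y + A * y ≈ β₂ →
    β₁ + β₂ ≈ - B → β₁ * β₂ ≈ C → ¬ (y ≈ φ s + φ t * x)
  affine-relation-impossible {x = x} s t wx wy β₁+β₂≈-B β₁β₂≈C y≈s+tx =
    rational-quadratic-impossible _ _ x (monic-rational-quadratic λ₂ λ₁ λ₀ x quadratic)
                                  (quartic-vanishes wx β₁+β₂≈-B β₁β₂≈C)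
    where
    λ₂ = ℚFormulas.relation₂ t
    λ₁ = ℚFormulas.relation₁ Â s t
    λ₀ = ℚFormulas.relation₀ Â B̂ s
    instance _ = one-plus-square-nonZero t
    quadratic : φ λ₂ * (x * x) + φ λ₁ * x + φ λ₀ ≈ 0#
    quadratic = trans (+-cong (+-cong (*-congʳ (φ-relation₂ t)) (*-congʳ (φ-relation₁ Â s t))) (φ-relation₀ Â B̂ s))
                      (linear-relation⇒quadratic wx wy β₁+β₂≈-B y≈s+tx)

  rational-linear-relation : ∀ {x x′ y y′} l₁ l₂ l₃ l₄ l₅ → x + x′ ≈ - A → y + y′ ≈ - A →
    InLR K x x′ y y′ (l₁ ∷ l₂ ∷ l₃ ∷ l₄ ∷ l₅ ∷ []) →
    φ (ℤ→ℚ (l₁ ℤ.- l₂)) * x + φ (ℤ→ℚ (l₃ ℤ.- l₄)) * y ≈ φ (ℤ→ℚ (l₅ ℤ.+ a ℤ.* (l₂ ℤ.+ l₄)))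
  rational-linear-relation {x} {x′} {y} {y′} l₁ l₂ l₃ l₄ l₅ x+x′≈-A y+y′≈-A relation = begin
    φ (ℤ→ℚ (l₁ ℤ.- l₂)) * x + φ (ℤ→ℚ (l₃ ℤ.- l₄)) * y
      ≈⟨ +-cong (*-congʳ (φ-difference l₁ l₂)) (*-congʳ (φ-difference l₃ l₄)) ⟩
    (intK K l₁ + - intK K l₂) * x + (intK K l₃ + - intK K l₄) * y
      ≈⟨ eliminate-conjugates x+x′≈-A y+y′≈-A relation ⟩
    intK K l₅ + A * (intK K l₂ + intK K l₄)
      ≈⟨ +-congˡ (*-cong (φ-int a) (sym (intK-+ l₂ l₄))) ⟩
    intK K l₅ + intK K a * intK K (l₂ ℤ.+ l₄)
      ≈⟨ sym (trans (intK-+ l₅ _) (+-congˡ (intK-* a _))) ⟩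
    intK K (l₅ ℤ.+ a ℤ.* (l₂ ℤ.+ l₄))
      ≈⟨ sym (φ-int (l₅ ℤ.+ a ℤ.* (l₂ ℤ.+ l₄))) ⟩
    φ (ℤ→ℚ (l₅ ℤ.+ a ℤ.* (l₂ ℤ.+ l₄))) ∎
    where
    φ-difference : ∀ i j → φ (ℤ→ℚ (i ℤ.- j)) ≈ intK K i + - intK K j
    φ-difference i j = trans (φ-int (i ℤ.- j)) (trans (intK-+ i (ℤ.- j)) (+-congˡ (intK-neg j)))

  rationally-independent : ∀ {β₁ β₂ x y} → x * x + A * x ≈ β₁ → y * y + A * y ≈ β₂ →
    β₁ + β₂ ≈ - B → β₁ * β₂ ≈ C →
    ∀ p q r → φ p * x + φ q * y ≈ φ r → (p ≡ 0ℚ) × (q ≡ 0ℚ) × (r ≡ 0ℚ)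
  rationally-independent {x = x} {y} wx wy β₁+β₂≈-B β₁β₂≈C p q r linear with q ℚ.≟ 0ℚ | p ℚ.≟ 0ℚ
  ... | yes q≡0 | yes p≡0 = p≡0 , q≡0 , φ-injective r (begin
    φ r               ≈⟨ sym linear ⟩
    φ p * x + φ q * y ≈⟨ +-cong (*-congʳ (≡0⇒φ≈0 p≡0)) (*-congʳ (≡0⇒φ≈0 q≡0)) ⟩
    0# * x + 0# * y   ≈⟨ trans (+-cong (zeroˡ x) (zeroˡ y)) (+-identityʳ 0#) ⟩
    0#                ∎)
  ... | yes q≡0 | no p≢0 = ⊥-elim (rational-root-impossible (ℚ.1/ p ℚ.* r)
                                    (trans (quartic-congʳ A B C (sym x≈ρ)) (quartic-vanishes wx β₁+β₂≈-B β₁β₂≈C)))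
    where
    instance _ = ℚ.≢-nonZero p≢0
    px≈r : φ p * x ≈ φ r
    px≈r = trans (sym (trans (+-congˡ (trans (*-congʳ (≡0⇒φ≈0 q≡0)) (zeroˡ y))) (+-identityʳ _))) linear
    x≈ρ : x ≈ φ (ℚ.1/ p ℚ.* r)
    x≈ρ = trans (rational-linear-solution p px≈r) (sym (φ-* (ℚ.1/ p) r))
  ... | no q≢0 | _ = ⊥-elim (affine-relation-impossible (ℚ.1/ q ℚ.* r) (ℚ.- (ℚ.1/ q ℚ.* p))
                                                        wx wy β₁+β₂≈-B β₁β₂≈C y≈s+tx)
    where
    instance _ = ℚ.≢-nonZero q≢0
    y≈s+tx : y ≈ φ (ℚ.1/ q ℚ.* r) + φ (ℚ.- (ℚ.1/ q ℚ.* p)) * x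
    y≈s+tx = begin
      y                                       ≈⟨ rational-linear-solution q (x≈z//y _ _ _ (trans (+-comm _ _) linear)) ⟩
      φ (ℚ.1/ q) * (φ r + - (φ p * x))        ≈⟨ solve 4 (λ i r p x → i :* (r :+ :- (p :* x)) := i :* r :+ :- (i :* p) :* x)
                                                           refl (φ (ℚ.1/ q)) (φ r) (φ p) x ⟩
      φ (ℚ.1/ q) * φ r + - (φ (ℚ.1/ q) * φ p) * x
                                              ≈⟨ sym (+-cong (φ-* _ _) (*-congʳ (trans (φ-neg _) (-‿cong (φ-* _ _))))) ⟩
      φ (ℚ.1/ q ℚ.* r) + φ (ℚ.- (ℚ.1/ q ℚ.* p)) * x ∎

  integer-relations-spanned : ∀ {β₁ β₂ x x′ y y′} → β₁ + β₂ ≈ - B → β₁ * β₂ ≈ C →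
    x + x′ ≈ - A → x * x′ ≈ - β₁ → y + y′ ≈ - A → y * y′ ≈ - β₂ →
    ∀ l → InLR K x x′ y y′ l → ∃₂ λ m₁ m₂ → l ≡ vecLin m₁ (relVec₁ a) m₂ (relVec₂ a)
  integer-relations-spanned β₁+β₂≈-B β₁β₂≈C x+x′≈-A xx′≈-β₁ y+y′≈-A yy′≈-β₂ (l₁ ∷ l₂ ∷ l₃ ∷ l₄ ∷ l₅ ∷ []) relation =
    l₂ , l₄ , relVecs-span a l₁ l₂ l₃ l₄ l₅
      (ℤP.i-j≡0⇒i≡j l₁ l₂ (ℤ→ℚ≡0⇒≡0 _ p≡0))
      (ℤP.i-j≡0⇒i≡j l₃ l₄ (ℤ→ℚ≡0⇒≡0 _ q≡0))
      (ℤP.i-j≡0⇒i≡j l₅ _ (≡.trans (≡.cong (λ w → l₅ ℤ.+ w) (ℤP.neg-involutive _)) (ℤ→ℚ≡0⇒≡0 _ r≡0)))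
    where
    vanishing = rationally-independent (vieta-quadratic x+x′≈-A xx′≈-β₁) (vieta-quadratic y+y′≈-A yy′≈-β₂)
                  β₁+β₂≈-B β₁β₂≈C _ _ _ (rational-linear-relation l₁ l₂ l₃ l₄ l₅ x+x′≈-A y+y′≈-A relation)
    p≡0 = proj₁ vanishing
    q≡0 = proj₁ (proj₂ vanishing)
    r≡0 = proj₂ (proj₂ vanishing)

proposition3p3 : {k ℓ : Level} (K : CommutativeRing k ℓ) →
    IsField K → CharZero K →
    (a b c : ℤ) → Irreducibleₚ (fPoly a b c) →
    let open CommutativeRing K in
    (β₁ β₂ α₁₁ α₁₂ α₂₁ α₂₂ : Carrier) →
    β₁ + β₂ ≈ - intK K b → β₁ * β₂ ≈ intK K c →
    α₁₁ + α₁₂ ≈ - intK K a → α₁₁ * α₁₂ ≈ - β₁ →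
    α₂₁ + α₂₂ ≈ - intK K a → α₂₁ * α₂₂ ≈ - β₂ →
    InLR K α₁₁ α₁₂ α₂₁ α₂₂ (relVec₁ a) ×
    InLR K α₁₁ α₁₂ α₂₁ α₂₂ (relVec₂ a) ×
    (∀ (m₁ m₂ : ℤ) → vecLin m₁ (relVec₁ a) m₂ (relVec₂ a) ≡ zeroVec → (m₁ ≡ + 0) × (m₂ ≡ + 0)) ×
    (∀ (l : Vec ℤ 5) → InLR K α₁₁ α₁₂ α₂₁ α₂₂ l →
      ∃₂ λ (m₁ m₂ : ℤ) → l ≡ vecLin m₁ (relVec₁ a) m₂ (relVec₂ a))
proposition3p3 K isField charZero a b c irreducible β₁ β₂ α₁₁ α₁₂ α₂₁ α₂₂
               β₁+β₂≈-b β₁β₂≈c α₁₁+α₁₂≈-a α₁₁α₁₂≈-β₁ α₂₁+α₂₂≈-a α₂₁α₂₂≈-β₂ =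
    relVec₁∈LR a α₁₁+α₁₂≈-a
  , relVec₂∈LR a α₂₁+α₂₂≈-a
  , relVecs-independent a
  , integer-relations-spanned (trans β₁+β₂≈-b (-‿cong (sym (φ-int b)))) (trans β₁β₂≈c (sym (φ-int c)))
                              (via-φ α₁₁+α₁₂≈-a) α₁₁α₁₂≈-β₁ (via-φ α₂₁+α₂₂≈-a) α₂₁α₂₂≈-β₂
  where
  open CommutativeRing K
  open RelationVectors using (relVecs-independent)
  open QuarticIdentities K using (relVec₁∈LR; relVec₂∈LR)
  open RationalEmbedding K isField charZero using (φ-int; φ)
  open QuarticRoots K isField charZero a b c irreducible using (integer-relations-spanned)

  via-φ : ∀ {s} → s ≈ - intK K a → s ≈ - φ (ℤ→ℚ a)
  via-φ s≈-a = trans s≈-a (-‿cong (sym (φ-int a)))
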